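{- For all integers $m\ge 2$ and $n\ge 1$, $\chi_{la}(C_{2m}\vee K_{2n})=2n+2$.
   Context: For a graph $G=(V,E)$, a local antimagic labeling is a bijection $f:E\to\{1,\dots,|E|\}$ such that, with $f^+(u)=\sum_{e\ni u} f(e)$, adjacent vertices receive distinct values of $f^+$; $c(f)$ is the number of distinct values of $f^+$ and $\chi_{la}(G)=\min c(f)$ over all local antimagic labelings. $C_k$ is the cycle on $k$ vertices, $K_k$ the complete graph on $k$ vertices, and $G\vee H$ the join (disjoint union plus all edges between $V(G)$ and $V(H)$). -}

module Defs where

open import Data.Nat using (ℕ; zero; suc; _+_; _∸_; _≤_; _<_)
open import Data.Nat.Properties using (_≟_)
open import Data.Fin using (Fin; toℕ)
open import Data.Nat.ListAction using (sum)
open import Data.List using (List; []; _∷_; _++_; length; map; concatMap; upTo; allFin; lookup; deduplicate)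
open import Data.Product using (_×_; _,_; proj₁; proj₂; Σ; ∃)
open import Relation.Nullary using (¬_; does)
open import Data.Bool using (if_then_else_; _∨_)
open import Relation.Binary.PropositionalEquality using (_≡_)
open import Function.Bundles using (Bijection; _⤖_)

-- A finite simple graph: vertices 0 .. order-1, an edge list of unordered pairs
-- (each edge listed exactly once).
record Graph : Set where
  constructor mkGraph
  field
    order : ℕ
    edges : List (ℕ × ℕ)
open Graph public

|E| : Graph → ℕ
|E| G = length (edges G)

edge : (G : Graph) → Fin (|E| G) → ℕ × ℕ
edge G e = lookup (edges G) e

-- A labeling is a bijection E → {1,…,|E|}; we index edges by Fin |E| and
-- identify {1,…,|E|} with Fin |E| via i ↦ toℕ i + 1.
Labeling : Graph → Set
Labeling G = Fin (|E| G) ⤖ Fin (|E| G)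

label : (G : Graph) → Labeling G → Fin (|E| G) → ℕ
label G f e = suc (toℕ (Bijection.to f e))

incident : ℕ → ℕ × ℕ → Data.Bool.Bool
incident u (a , b) = does (u ≟ a) ∨ does (u ≟ b)

fplus : (G : Graph) → Labeling G → ℕ → ℕ
fplus G f u = sum (map (λ e → if incident u (edge G e) then label G f e else 0) (allFin (|E| G)))

IsLocalAntimagic : (G : Graph) → Labeling G → Set
IsLocalAntimagic G f = (e : Fin (|E| G)) →
  ¬ (fplus G f (proj₁ (edge G e)) ≡ fplus G f (proj₂ (edge G e)))

colours : (G : Graph) → Labeling G → ℕ
colours G f = length (deduplicate _≟_ (map (fplus G f) (upTo (order G))))

LocalAntimagicChromatic : Graph → ℕ → Set
LocalAntimagicChromatic G k =
  (Σ (Labeling G) λ f → IsLocalAntimagic G f × colours G f ≡ k) ×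
  ((f : Labeling G) → IsLocalAntimagic G f → k ≤ colours G f)

cycleEdges : ℕ → List (ℕ × ℕ)
cycleEdges k = map (λ i → (i , suc i)) (upTo (k ∸ 1)) ++ ((k ∸ 1 , 0) ∷ [])

cliqueEdges : ℕ → ℕ → List (ℕ × ℕ)
cliqueEdges o s = concatMap (λ j → map (λ i → (o + i , o + j)) (upTo j)) (upTo s)

joinEdges : ℕ → ℕ → List (ℕ × ℕ)
joinEdges p q = concatMap (λ i → map (λ j → (i , p + j)) (upTo q)) (upTo p)

-- C_k ∨ K_s : cycle on 0..k-1, clique on k..k+s-1, plus all edges between
cycleJoinComplete : ℕ → ℕ → Graph
cycleJoinComplete k s = mkGraph (k + s) (cycleEdges k ++ cliqueEdges k s ++ joinEdges k s)

-- Lower bound: the cycle vertices 0, 1 and the s clique vertices are pairwise adjacent, so a local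
-- antimagic labeling gives them s + 2 distinct values.  Upper bound: the cycle edges get the labels
-- 1, …, k, the join edges at clique vertex j the block k + jk + 1, …, k + (j+1)k, distributed over
-- the cycle vertices by a permutation π j, and the clique edges the largest labels.  With π 1 the
-- negation modulo k, π 0 a parity-preserving swap of pairs and the other π j alternately identity
-- and reflection, the value of a cycle vertex depends only on its parity; the clique values
-- increase strictly and exceed all cycle values, so exactly s + 2 values occur.
module Submission where

open import Defs
open import Data.Nat using (ℕ; zero; suc; _+_; _*_; _∸_; _≤_; _<_; z≤n; s≤s; s≤s⁻¹; z<s; s<s; _≟_; _≡ᵇ_; _<?_; NonZero)
open import Data.Nat.Properties
open import Data.Nat.DivMod
  using (_/_; _%_; m≡m%n+[m/n]*n; [m+kn]%n≡m%n; m<n⇒m%n≡m; m*n%n≡0; m%n<n; +-distrib-/; m<n⇒m/n≡0; m*n/n≡m; m<n*o⇒m/o<n)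
open import Data.Nat.ListAction using (sum)
open import Data.Nat.Tactic.RingSolver using (solve-∀)
open import Data.Bool using (Bool; true; false; if_then_else_; _∨_)
open import Data.Bool.Properties using (∨-zeroʳ; ∨-identityʳ)
open import Data.Fin using (Fin; toℕ; fromℕ<) renaming (zero to fzero; suc to fsuc)
open import Data.Fin.Properties using (injective⇒≤; toℕ-fromℕ<; toℕ-injective; toℕ<n)
open import Data.List using (List; []; _∷_; _++_; length; map; concatMap; upTo; applyUpTo; lookup; deduplicate; tabulate)
open import Data.List.Properties using (length-++; length-map; length-applyUpTo; length-upTo; map-tabulate)
open import Data.List.Relation.Unary.All as All using (All; _∷_)
import Data.List.Relation.Unary.All.Properties as Allₚ
open import Data.List.Relation.Unary.AllPairs as AllPairs using (AllPairs; _∷_)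
import Data.List.Relation.Unary.AllPairs.Properties as AllPairsₚ
import Data.List.Relation.Unary.Any as Any
open import Data.List.Relation.Unary.Any using (here; there)
open import Data.List.Relation.Unary.Any.Properties using (lookup-index; applyUpTo⁺; applyUpTo⁻)
open import Data.List.Relation.Unary.Unique.Propositional using (Unique)
open import Data.List.Relation.Unary.Unique.DecPropositional.Properties using (deduplicate-!)
open import Data.List.Membership.Propositional using (_∈_)
open import Data.List.Membership.Propositional.Properties using (∈-lookup; ∈-++⁺ˡ; ∈-++⁺ʳ; ∈-++⁻; ∈-map⁺; ∈-map⁻; ∈-upTo⁺; ∈-upTo⁻; ∈-concatMap⁺; ∈-concatMap⁻; ∈-deduplicate⁺; ∈-deduplicate⁻)
open import Data.Product using (_×_; _,_; proj₁; proj₂)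
open import Data.Sum using (_⊎_; inj₁; inj₂)
open import Function.Bundles using (mk↔ₛ′)
open import Function.Properties.Inverse using (↔⇒⤖)
open import Relation.Nullary using (¬_; Dec; yes; no; contradiction)
open import Relation.Nullary.Decidable using (dec-true; dec-false)
open import Relation.Binary.PropositionalEquality
open import Algebra.Properties.CommutativeSemigroup +-commutativeSemigroup using (interchange)

∑ : ℕ → (ℕ → ℕ) → ℕ
∑ zero    f = 0
∑ (suc n) f = f 0 + ∑ n (λ i → f (suc i))

syntax ∑ n (λ i → e) = ∑[ i < n ] e

∑-cong : ∀ n {f g : ℕ → ℕ} → (∀ i → i < n → f i ≡ g i) → ∑ n f ≡ ∑ n g
∑-cong zero    eq = refl
∑-cong (suc n) eq = cong₂ _+_ (eq 0 z<s) (∑-cong n (λ i i<n → eq (suc i) (s<s i<n)))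

∑-mono : ∀ n {f g : ℕ → ℕ} → (∀ i → i < n → f i ≤ g i) → ∑ n f ≤ ∑ n g
∑-mono zero    le = z≤n
∑-mono (suc n) le = +-mono-≤ (le 0 z<s) (∑-mono n (λ i i<n → le (suc i) (s<s i<n)))

∑-split : ∀ a b (f : ℕ → ℕ) → ∑ (a + b) f ≡ ∑ a f + ∑[ i < b ] f (a + i)
∑-split zero    b f = refl
∑-split (suc a) b f = trans (cong (f 0 +_) (∑-split a b (λ i → f (suc i)))) (sym (+-assoc (f 0) _ _))

∑-last : ∀ n (f : ℕ → ℕ) → ∑ (suc n) f ≡ ∑ n f + f n
∑-last zero    f = +-identityʳ (f 0)
∑-last (suc n) f = trans (cong (f 0 +_) (∑-last n (λ i → f (suc i)))) (sym (+-assoc (f 0) _ _))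

∑-around : ∀ t r (f : ℕ → ℕ) → ∑ (t + suc (suc r)) f ≡ ∑ t f + (f t + (f (suc t) + ∑[ i < r ] f (t + suc (suc i))))
∑-around t r f = trans (∑-split t (suc (suc r)) f)
  (cong (∑ t f +_) (cong₂ _+_ (cong f (+-identityʳ t)) (cong (_+ ∑[ i < r ] f (t + suc (suc i))) (cong f (+-comm t 1)))))

∑-+ : ∀ n (f g : ℕ → ℕ) → ∑[ i < n ] (f i + g i) ≡ ∑ n f + ∑ n g
∑-+ zero    f g = refl
∑-+ (suc n) f g = begin
  f 0 + g 0 + ∑[ i < n ] (f (suc i) + g (suc i))
    ≡⟨ cong (f 0 + g 0 +_) (∑-+ n (λ i → f (suc i)) (λ i → g (suc i))) ⟩
  f 0 + g 0 + (∑ n (λ i → f (suc i)) + ∑ n (λ i → g (suc i)))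
    ≡⟨ interchange (f 0) (g 0) _ _ ⟩
  f 0 + ∑ n (λ i → f (suc i)) + (g 0 + ∑ n (λ i → g (suc i))) ∎
  where open ≡-Reasoning

∑-const : ∀ n c → ∑[ i < n ] c ≡ n * c
∑-const zero    c = refl
∑-const (suc n) c = cong (c +_) (∑-const n c)

∑-zero : ∀ n {f : ℕ → ℕ} → (∀ i → i < n → f i ≡ 0) → ∑ n f ≡ 0
∑-zero n vanish = trans (∑-cong n vanish) (trans (∑-const n 0) (*-zeroʳ n))

increasing-by-steps : ∀ (f : ℕ → ℕ) n → (∀ t → suc t < n → f t < f (suc t)) → ∀ {i j} → i < j → j < n → f i < f j
increasing-by-steps f n step {i} {suc j} i<1+j 1+j<n with m≤n⇒m<n∨m≡n (s≤s⁻¹ i<1+j)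
... | inj₁ i<j  = <-trans (increasing-by-steps f n step i<j (<-trans (n<1+n j) 1+j<n)) (step j 1+j<n)
... | inj₂ refl = step i 1+j<n

≡ᵇ-refl : ∀ u → (u ≡ᵇ u) ≡ true
≡ᵇ-refl u = dec-true (u ≟ u) refl

≢⇒≡ᵇ-false : ∀ {u i} → ¬ u ≡ i → (u ≡ᵇ i) ≡ false
≢⇒≡ᵇ-false {u} {i} = dec-false (u ≟ i)

<⇒≡ᵇ-false : ∀ {u i} → u < i → (u ≡ᵇ i) ≡ false
<⇒≡ᵇ-false u<i = ≢⇒≡ᵇ-false (<⇒≢ u<i)

>⇒≡ᵇ-false : ∀ {u i} → i < u → (u ≡ᵇ i) ≡ false
>⇒≡ᵇ-false i<u = ≢⇒≡ᵇ-false (>⇒≢ i<u)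

≡ᵇ-+ : ∀ k u i → (k + u ≡ᵇ k + i) ≡ (u ≡ᵇ i)
≡ᵇ-+ zero    u i = refl
≡ᵇ-+ (suc k) u i = ≡ᵇ-+ k u i

∑-indicator : ∀ n u (f : ℕ → ℕ) → u < n → ∑[ i < n ] (if u ≡ᵇ i then f i else 0) ≡ f u
∑-indicator (suc n) zero    f _ = trans (cong (f 0 +_) (∑-zero n (λ i _ → refl))) (+-identityʳ (f 0))
∑-indicator (suc n) (suc u) f (s≤s u<n) = ∑-indicator n u (λ i → f (suc i)) u<n

∑-indicator-out : ∀ n u (f : ℕ → ℕ) → n ≤ u → ∑[ i < n ] (if u ≡ᵇ i then f i else 0) ≡ 0
∑-indicator-out zero    u       f _ = refl
∑-indicator-out (suc n) (suc u) f (s≤s n≤u) = ∑-indicator-out n u (λ i → f (suc i)) n≤u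

∑-guard : ∀ n (b : Bool) (c : ℕ → Bool) (f : ℕ → ℕ) → (∀ j → j < n → c j ≡ false) →
  ∑[ j < n ] (if b ∨ c j then f j else 0) ≡ (if b then ∑ n f else 0)
∑-guard n true  c f _        = refl
∑-guard n false c f c≡false = ∑-zero n (λ j j<n → cong (λ g → if g then f j else 0) (c≡false j j<n))

-- The weight of the edges of es incident to u, where the edge at position p of es weighs w (o + p).
incidentSum : (ℕ → ℕ) → ℕ → List (ℕ × ℕ) → ℕ → ℕ
incidentSum w u []       o = 0
incidentSum w u (e ∷ es) o = (if incident u e then w o else 0) + incidentSum w u es (suc o)

incidentSum-++ : ∀ w u xs ys o →
  incidentSum w u (xs ++ ys) o ≡ incidentSum w u xs o + incidentSum w u ys (o + length xs)
incidentSum-++ w u []       ys o = cong (incidentSum w u ys) (sym (+-identityʳ o))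
incidentSum-++ w u (x ∷ xs) ys o = begin
  W x + incidentSum w u (xs ++ ys) (suc o)
    ≡⟨ cong (W x +_) (incidentSum-++ w u xs ys (suc o)) ⟩
  W x + (incidentSum w u xs (suc o) + incidentSum w u ys (suc o + length xs))
    ≡⟨ sym (+-assoc (W x) _ _) ⟩
  W x + incidentSum w u xs (suc o) + incidentSum w u ys (suc o + length xs)
    ≡⟨ cong (λ z → W x + incidentSum w u xs (suc o) + incidentSum w u ys z) (sym (+-suc o (length xs))) ⟩
  W x + incidentSum w u xs (suc o) + incidentSum w u ys (o + suc (length xs)) ∎
  where
  open ≡-Reasoning
  W : ℕ × ℕ → ℕ
  W e = if incident u e then w o else 0

incidentSum-map : ∀ w u (h : ℕ → ℕ × ℕ) (g : ℕ → ℕ) n o →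
  incidentSum w u (map h (applyUpTo g n)) o ≡ ∑[ i < n ] (if incident u (h (g i)) then w (o + i) else 0)
incidentSum-map w u h g zero    o = refl
incidentSum-map w u h g (suc n) o =
  cong₂ _+_ (cong (λ p → if incident u (h (g 0)) then w p else 0) (sym (+-identityʳ o)))
    (trans (incidentSum-map w u h (λ i → g (suc i)) n (suc o))
      (∑-cong n (λ i _ → cong (λ p → if incident u (h (g (suc i))) then w p else 0) (sym (+-suc o i)))))

incidentSum-concatMap : ∀ w u (b : ℕ → List (ℕ × ℕ)) (g : ℕ → ℕ) n o →
  incidentSum w u (concatMap b (applyUpTo g n)) o ≡
  ∑[ i < n ] incidentSum w u (b (g i)) (o + ∑[ i′ < i ] length (b (g i′)))
incidentSum-concatMap w u b g zero    o = refl
incidentSum-concatMap w u b g (suc n) o = begin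
  incidentSum w u (b (g 0) ++ concatMap b (applyUpTo (λ i → g (suc i)) n)) o
    ≡⟨ incidentSum-++ w u (b (g 0)) _ o ⟩
  incidentSum w u (b (g 0)) o + incidentSum w u (concatMap b (applyUpTo (λ i → g (suc i)) n)) (o + length (b (g 0)))
    ≡⟨ cong₂ _+_ (cong (incidentSum w u (b (g 0))) (sym (+-identityʳ o)))
         (trans (incidentSum-concatMap w u b (λ i → g (suc i)) n _)
           (∑-cong n (λ i _ → cong (incidentSum w u (b (g (suc i)))) (+-assoc o _ _)))) ⟩
  incidentSum w u (b (g 0)) (o + 0) +
    ∑[ i < n ] incidentSum w u (b (g (suc i))) (o + (length (b (g 0)) + ∑[ i′ < i ] length (b (g (suc i′))))) ∎
  where open ≡-Reasoning

length-concatMap : ∀ {A : Set} (b : ℕ → List A) (g : ℕ → ℕ) n →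
  length (concatMap b (applyUpTo g n)) ≡ ∑[ i < n ] length (b (g i))
length-concatMap b g zero    = refl
length-concatMap b g (suc n) =
  trans (length-++ (b (g 0))) (cong (length (b (g 0)) +_) (length-concatMap b (λ i → g (suc i)) n))

sum-tabulate-incident : ∀ u w (xs : List (ℕ × ℕ)) (g : Fin (length xs) → ℕ) o →
  (∀ e → g e ≡ (if incident u (lookup xs e) then w (o + toℕ e) else 0)) →
  sum (tabulate g) ≡ incidentSum w u xs o
sum-tabulate-incident u w []       g o eq = refl
sum-tabulate-incident u w (x ∷ xs) g o eq =
  cong₂ _+_ (trans (eq fzero) (cong (λ p → if incident u x then w p else 0) (+-identityʳ o)))
    (sum-tabulate-incident u w xs (λ e → g (fsuc e)) (suc o)
      (λ e → trans (eq (fsuc e)) (cong (λ p → if incident u (lookup xs e) then w p else 0) (+-suc o (toℕ e)))))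

-- A permutation σ of the edge positions {0, …, |E| ∸ 1}, given together with its inverse τ,
-- defines the labeling that gives the edge at position p the label σ p + 1.
module PermutationLabeling (G : Graph) (σ τ : ℕ → ℕ)
  (σ-< : ∀ p → p < |E| G → σ p < |E| G) (τ-< : ∀ r → r < |E| G → τ r < |E| G)
  (τ∘σ : ∀ p → p < |E| G → τ (σ p) ≡ p) (σ∘τ : ∀ r → r < |E| G → σ (τ r) ≡ r) where

  private
    onFin : (h : ℕ → ℕ) → (∀ p → p < |E| G → h p < |E| G) → Fin (|E| G) → Fin (|E| G)
    onFin h h-< x = fromℕ< (h-< (toℕ x) (toℕ<n x))

    toℕ-onFin : ∀ h h-< x → toℕ (onFin h h-< x) ≡ h (toℕ x)
    toℕ-onFin h h-< x = toℕ-fromℕ< (h-< (toℕ x) (toℕ<n x))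

  permLabeling : Labeling G
  permLabeling = ↔⇒⤖ (mk↔ₛ′ (onFin σ σ-<) (onFin τ τ-<)
    (λ y → toℕ-injective (trans (toℕ-onFin σ σ-< _) (trans (cong σ (toℕ-onFin τ τ-< y)) (σ∘τ (toℕ y) (toℕ<n y)))))
    (λ x → toℕ-injective (trans (toℕ-onFin τ τ-< _) (trans (cong τ (toℕ-onFin σ σ-< x)) (τ∘σ (toℕ x) (toℕ<n x))))))

  fplus-permLabeling : ∀ u → fplus G permLabeling u ≡ incidentSum (λ p → suc (σ p)) u (edges G) 0
  fplus-permLabeling u =
    trans (cong sum (map-tabulate {n = |E| G} (λ x → x) (λ e → if incident u (edge G e) then label G permLabeling e else 0)))
      (sum-tabulate-incident u (λ p → suc (σ p)) (edges G) _ 0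
        (λ e → cong (λ l → if incident u (edge G e) then suc l else 0) (toℕ-onFin σ σ-< e)))

vertexValues : (G : Graph) → Labeling G → List ℕ
vertexValues G f = deduplicate _≟_ (map (fplus G f) (upTo (order G)))

unique-length≤ : ∀ {A : Set} {xs ys : List A} → Unique xs → (∀ {x} → x ∈ xs → x ∈ ys) → length xs ≤ length ys
unique-length≤ {xs = xs} {ys} xs! xs⊆ys = injective⇒≤ position-injective
  where
  position : Fin (length xs) → Fin (length ys)
  position i = Any.index (xs⊆ys (∈-lookup i))

  lookup-injective : ∀ {zs : List _} → Unique zs → ∀ {i j} → lookup zs i ≡ lookup zs j → i ≡ j
  lookup-injective (_ ∷ _)    {fzero}  {fzero}  _  = refl
  lookup-injective (z∉ ∷ _)   {fzero}  {fsuc j} eq = contradiction eq (All.lookup z∉ (∈-lookup j))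
  lookup-injective (z∉ ∷ _)   {fsuc i} {fzero}  eq = contradiction (sym eq) (All.lookup z∉ (∈-lookup i))
  lookup-injective (_ ∷ zs!)  {fsuc i} {fsuc j} eq = cong fsuc (lookup-injective zs! eq)

  position-injective : ∀ {i j} → position i ≡ position j → i ≡ j
  position-injective {i} {j} eq = lookup-injective xs! (begin
    lookup xs i                   ≡⟨ lookup-index (xs⊆ys (∈-lookup i)) ⟩
    lookup ys (position i)        ≡⟨ cong (lookup ys) eq ⟩
    lookup ys (position j)        ≡⟨ lookup-index (xs⊆ys (∈-lookup j)) ⟨
    lookup xs j                   ∎)
    where open ≡-Reasoning

module _ (G : Graph) (f : Labeling G) where

  separates : IsLocalAntimagic G f → ∀ {u v} → (u , v) ∈ edges G → ¬ fplus G f u ≡ fplus G f v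
  separates antimagic uv∈E = subst (λ e → ¬ fplus G f (proj₁ e) ≡ fplus G f (proj₂ e))
    (sym (lookup-index uv∈E)) (antimagic (Any.index uv∈E))

  clique≤colours : IsLocalAntimagic G f → (vs : List ℕ) → All (_< order G) vs →
    AllPairs (λ u v → (u , v) ∈ edges G) vs → length vs ≤ colours G f
  clique≤colours antimagic vs vs<n clique = begin
    length vs                         ≡⟨ length-map (fplus G f) vs ⟨
    length (map (fplus G f) vs)       ≤⟨ unique-length≤ distinct included ⟩
    colours G f                       ∎
    where
    open ≤-Reasoning
    distinct : Unique (map (fplus G f) vs)
    distinct = AllPairsₚ.map⁺ (AllPairs.map (separates antimagic) clique)
    included : ∀ {x} → x ∈ map (fplus G f) vs → x ∈ vertexValues G f
    included x∈ with v , v∈ , refl ← ∈-map⁻ (fplus G f) x∈ =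
      ∈-deduplicate⁺ _≟_ (∈-map⁺ (fplus G f) (∈-upTo⁺ (All.lookup vs<n v∈)))

  colours≤ : (vs : List ℕ) → (∀ u → u < order G → fplus G f u ∈ map (fplus G f) vs) → colours G f ≤ length vs
  colours≤ vs covered = begin
    colours G f                   ≤⟨ unique-length≤ (deduplicate-! _≟_ _) included ⟩
    length (map (fplus G f) vs)   ≡⟨ length-map (fplus G f) vs ⟩
    length vs                     ∎
    where
    open ≤-Reasoning
    included : ∀ {x} → x ∈ vertexValues G f → x ∈ map (fplus G f) vs
    included x∈ with u , u∈ , refl ← ∈-map⁻ (fplus G f) (∈-deduplicate⁻ _≟_ _ x∈) =
      covered u (∈-upTo⁻ u∈)

chromatic-by-clique : (G : Graph) (vs : List ℕ) → All (_< order G) vs →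
  AllPairs (λ u v → (u , v) ∈ edges G) vs → (f : Labeling G) → IsLocalAntimagic G f →
  (∀ u → u < order G → fplus G f u ∈ map (fplus G f) vs) → LocalAntimagicChromatic G (length vs)
chromatic-by-clique G vs vs<n clique f antimagic covered =
  (f , antimagic , ≤-antisym (colours≤ G f vs covered) (clique≤colours G f antimagic vs vs<n clique)) ,
  (λ g g-antimagic → clique≤colours G g g-antimagic vs vs<n clique)

mixed-< : ∀ {a d i j} → i < a → j < d → i * d + j < a * d
mixed-< {a} {d} {i} {j} i<a j<d = begin-strict
  i * d + j   <⟨ +-monoʳ-< (i * d) j<d ⟩
  i * d + d   ≡⟨ +-comm (i * d) d ⟩
  suc i * d   ≤⟨ *-monoˡ-≤ d i<a ⟩
  a * d       ∎
  where open ≤-Reasoning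

mixed-% : ∀ i {j} d .{{_ : NonZero d}} → j < d → (i * d + j) % d ≡ j
mixed-% i {j} d j<d = trans (cong (_% d) (+-comm (i * d) j)) (trans ([m+kn]%n≡m%n j i d) (m<n⇒m%n≡m j<d))

mixed-/ : ∀ i {j} d .{{_ : NonZero d}} → j < d → (i * d + j) / d ≡ i
mixed-/ i {j} d j<d = begin
  (i * d + j) / d          ≡⟨ cong (_/ d) (+-comm (i * d) j) ⟩
  (j + i * d) / d          ≡⟨ +-distrib-/ j (i * d) remainders<d ⟩
  j / d + i * d / d        ≡⟨ cong₂ _+_ (m<n⇒m/n≡0 j<d) (m*n/n≡m i d) ⟩
  i                        ∎
  where
  open ≡-Reasoning
  remainders<d : j % d + (i * d) % d < d
  remainders<d = subst (_< d) (sym (trans (cong₂ _+_ (m<n⇒m%n≡m j<d) (m*n%n≡0 i d)) (+-identityʳ j))) j<d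

mixed-decompose : ∀ x d .{{_ : NonZero d}} → x ≡ x / d * d + x % d
mixed-decompose x d = trans (m≡m%n+[m/n]*n x d) (+-comm (x % d) _)

-- View [0, k * s) as a k × s matrix stored row by row (x = i * s + j) and re-store it column by
-- column, permuting each column j by the involution π j: the entry (i , j) moves to j * k + π j i.
module TwistedTranspose (k s : ℕ) .{{_ : NonZero k}} .{{_ : NonZero s}} (π : ℕ → ℕ → ℕ)
  (π-< : ∀ j {v} → v < k → π j v < k) (π-involutive : ∀ j {v} → v < k → π j (π j v) ≡ v) where

  twist : ℕ → ℕ
  twist x = x % s * k + π (x % s) (x / s)

  untwist : ℕ → ℕ
  untwist y = π (y / k) (y % k) * s + y / k

  twist-mixed : ∀ i {j} → j < s → twist (i * s + j) ≡ j * k + π j i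
  twist-mixed i j<s = cong₂ (λ j i′ → j * k + π j i′) (mixed-% i s j<s) (mixed-/ i s j<s)

  untwist-mixed : ∀ j {v} → v < k → untwist (j * k + v) ≡ π j v * s + j
  untwist-mixed j v<k = cong₂ (λ j′ v′ → π j′ v′ * s + j′) (mixed-/ j k v<k) (mixed-% j k v<k)

  row-< : ∀ {x} → x < k * s → x / s < k
  row-< x<ks = m<n*o⇒m/o<n x<ks

  column-< : ∀ {y} → y < k * s → y / k < s
  column-< {y} y<ks = m<n*o⇒m/o<n (subst (y <_) (*-comm k s) y<ks)

  twist-< : ∀ {x} → x < k * s → twist x < k * s
  twist-< {x} x<ks = subst (twist x <_) (*-comm s k) (mixed-< (m%n<n x s) (π-< (x % s) (row-< x<ks)))

  untwist-< : ∀ {y} → y < k * s → untwist y < k * s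
  untwist-< {y} y<ks = mixed-< (π-< (y / k) (m%n<n y k)) (column-< y<ks)

  untwist∘twist : ∀ {x} → x < k * s → untwist (twist x) ≡ x
  untwist∘twist {x} x<ks = begin
    untwist (twist x)                               ≡⟨ untwist-mixed (x % s) (π-< (x % s) (row-< x<ks)) ⟩
    π (x % s) (π (x % s) (x / s)) * s + x % s       ≡⟨ cong (λ i → i * s + x % s) (π-involutive (x % s) (row-< x<ks)) ⟩
    x / s * s + x % s                               ≡⟨ mixed-decompose x s ⟨
    x                                               ∎
    where open ≡-Reasoning

  twist∘untwist : ∀ {y} → y < k * s → twist (untwist y) ≡ y
  twist∘untwist {y} y<ks = begin
    twist (untwist y)                               ≡⟨ twist-mixed (π (y / k) (y % k)) (column-< y<ks) ⟩
    y / k * k + π (y / k) (π (y / k) (y % k))       ≡⟨ cong (y / k * k +_) (π-involutive (y / k) (m%n<n y k)) ⟩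
    y / k * k + y % k                               ≡⟨ mixed-decompose y k ⟨
    y                                               ∎
    where open ≡-Reasoning

offset-< : ∀ {o p n} → o ≤ p → p < o + n → p ∸ o < n
offset-< {o} {p} {n} o≤p p<o+n = +-cancelˡ-< o (p ∸ o) n (subst (_< o + n) (sym (m+[n∸m]≡n o≤p)) p<o+n)

data Trichotomy (p lo hi : ℕ) : Set where
  below   : p < lo → Trichotomy p lo hi
  between : lo ≤ p → p < hi → Trichotomy p lo hi
  above   : hi ≤ p → Trichotomy p lo hi

trichotomy : ∀ p lo hi → Trichotomy p lo hi
trichotomy p lo hi with p <? lo | p <? hi
... | yes p<lo | _        = below p<lo
... | no  p≮lo | yes p<hi = between (≮⇒≥ p≮lo) p<hi
... | no  _    | no  p≮hi = above (≮⇒≥ p≮hi)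

-- The permutation of [0, a + b + c) fixing [0, a), moving the block [a, a + b) to the end, and
-- moving the block [a + b, a + b + c) to [a, a + c), permuting it by twist.
module BlockSwap (a b c : ℕ) (twist untwist : ℕ → ℕ)
  (twist-< : ∀ {x} → x < c → twist x < c) (untwist-< : ∀ {y} → y < c → untwist y < c)
  (untwist∘twist : ∀ {x} → x < c → untwist (twist x) ≡ x) (twist∘untwist : ∀ {y} → y < c → twist (untwist y) ≡ y) where

  swap : ℕ → ℕ
  swap p with trichotomy p a (a + b)
  ... | below _     = p
  ... | between _ _ = p + c
  ... | above _     = a + twist (p ∸ (a + b))

  unswap : ℕ → ℕ
  unswap r with trichotomy r a (a + c)
  ... | below _     = r
  ... | between _ _ = a + b + untwist (r ∸ a)
  ... | above _     = r ∸ c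

  swap-below : ∀ {p} → p < a → swap p ≡ p
  swap-below {p} p<a with trichotomy p a (a + b)
  ... | below _         = refl
  ... | between a≤p _   = contradiction p<a (≤⇒≯ a≤p)
  ... | above a+b≤p     = contradiction p<a (≤⇒≯ (≤-trans (m≤m+n a b) a+b≤p))

  swap-between : ∀ {p} → a ≤ p → p < a + b → swap p ≡ p + c
  swap-between {p} a≤p p<a+b with trichotomy p a (a + b)
  ... | below p<a       = contradiction p<a (≤⇒≯ a≤p)
  ... | between _ _     = refl
  ... | above a+b≤p     = contradiction p<a+b (≤⇒≯ a+b≤p)

  swap-above : ∀ {p} → a + b ≤ p → swap p ≡ a + twist (p ∸ (a + b))
  swap-above {p} a+b≤p with trichotomy p a (a + b)
  ... | below p<a       = contradiction p<a (≤⇒≯ (≤-trans (m≤m+n a b) a+b≤p))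
  ... | between _ p<a+b = contradiction p<a+b (≤⇒≯ a+b≤p)
  ... | above _         = refl

  unswap-below : ∀ {r} → r < a → unswap r ≡ r
  unswap-below {r} r<a with trichotomy r a (a + c)
  ... | below _         = refl
  ... | between a≤r _   = contradiction r<a (≤⇒≯ a≤r)
  ... | above a+c≤r     = contradiction r<a (≤⇒≯ (≤-trans (m≤m+n a c) a+c≤r))

  unswap-between : ∀ {r} → a ≤ r → r < a + c → unswap r ≡ a + b + untwist (r ∸ a)
  unswap-between {r} a≤r r<a+c with trichotomy r a (a + c)
  ... | below r<a       = contradiction r<a (≤⇒≯ a≤r)
  ... | between _ _     = refl
  ... | above a+c≤r     = contradiction r<a+c (≤⇒≯ a+c≤r)

  unswap-above : ∀ {r} → a + c ≤ r → unswap r ≡ r ∸ c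
  unswap-above {r} a+c≤r with trichotomy r a (a + c)
  ... | below r<a       = contradiction r<a (≤⇒≯ (≤-trans (m≤m+n a c) a+c≤r))
  ... | between _ r<a+c = contradiction r<a+c (≤⇒≯ a+c≤r)
  ... | above _         = refl

  swap-< : ∀ {p} → p < a + b + c → swap p < a + b + c
  swap-< {p} p<N with trichotomy p a (a + b)
  ... | below _         = p<N
  ... | between _ p<a+b = +-monoˡ-< c p<a+b
  ... | above a+b≤p     = begin-strict
    a + twist (p ∸ (a + b))   <⟨ +-monoʳ-< a (twist-< (offset-< a+b≤p p<N)) ⟩
    a + c                     ≤⟨ +-monoˡ-≤ c (m≤m+n a b) ⟩
    a + b + c                 ∎
    where open ≤-Reasoning

  unswap-< : ∀ {r} → r < a + b + c → unswap r < a + b + c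
  unswap-< {r} r<N with trichotomy r a (a + c)
  ... | below _           = r<N
  ... | between a≤r r<a+c = +-monoʳ-< (a + b) (untwist-< (offset-< a≤r r<a+c))
  ... | above _           = ≤-<-trans (m∸n≤m r c) r<N

  unswap∘swap : ∀ {p} → p < a + b + c → unswap (swap p) ≡ p
  unswap∘swap {p} p<N with trichotomy p a (a + b)
  ... | below p<a         = unswap-below p<a
  ... | between a≤p _     = trans (unswap-above (+-monoˡ-≤ c a≤p)) (m+n∸n≡m p c)
  ... | above a+b≤p       = begin
    unswap (a + twist q)                   ≡⟨ unswap-between (m≤m+n a (twist q)) (+-monoʳ-< a (twist-< q<c)) ⟩
    a + b + untwist (a + twist q ∸ a)      ≡⟨ cong (λ y → a + b + untwist y) (m+n∸m≡n a (twist q)) ⟩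
    a + b + untwist (twist q)              ≡⟨ cong (a + b +_) (untwist∘twist q<c) ⟩
    a + b + q                              ≡⟨ m+[n∸m]≡n a+b≤p ⟩
    p                                      ∎
    where
    open ≡-Reasoning
    q = p ∸ (a + b)
    q<c : q < c
    q<c = offset-< a+b≤p p<N

  swap∘unswap : ∀ {r} → r < a + b + c → swap (unswap r) ≡ r
  swap∘unswap {r} r<N with trichotomy r a (a + c)
  ... | below r<a         = swap-below r<a
  ... | between a≤r r<a+c = begin
    swap (a + b + untwist y)               ≡⟨ swap-above (m≤m+n (a + b) (untwist y)) ⟩
    a + twist (a + b + untwist y ∸ (a + b)) ≡⟨ cong (λ x → a + twist x) (m+n∸m≡n (a + b) (untwist y)) ⟩
    a + twist (untwist y)                  ≡⟨ cong (a +_) (twist∘untwist (offset-< a≤r r<a+c)) ⟩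
    a + y                                  ≡⟨ m+[n∸m]≡n a≤r ⟩
    r                                      ∎
    where
    open ≡-Reasoning
    y = r ∸ a
  ... | above a+c≤r       = trans (swap-between a≤r-c r-c<a+b) (m∸n+n≡m (≤-trans (m≤n+m c a) a+c≤r))
    where
    a≤r-c : a ≤ r ∸ c
    a≤r-c = subst (_≤ r ∸ c) (m+n∸n≡m a c) (∸-monoˡ-≤ c a+c≤r)
    r-c<a+b : r ∸ c < a + b
    r-c<a+b = subst (r ∸ c <_) (m+n∸n≡m (a + b) c) (∸-monoˡ-< r<N (≤-trans (m≤n+m c a) a+c≤r))

-- The n-th triangular number 0 + 1 + … + (n ∸ 1): the number of edges of K_n.
triangle : ℕ → ℕ
triangle n = ∑[ i < n ] i

triangle-mono : ∀ {m n} → m ≤ n → triangle m ≤ triangle n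
triangle-mono {m} {n} m≤n = begin
  triangle m                           ≤⟨ m≤m+n (triangle m) _ ⟩
  triangle m + ∑[ i < n ∸ m ] (m + i)  ≡⟨ ∑-split m (n ∸ m) (λ i → i) ⟨
  ∑ (m + (n ∸ m)) (λ i → i)            ≡⟨ cong triangle (m+[n∸m]≡n m≤n) ⟩
  triangle n                           ∎
  where open ≤-Reasoning

incident-pathEdge : ∀ u i x →
  (if incident u (i , suc i) then x else 0) ≡ (if u ≡ᵇ i then x else 0) + (if u ≡ᵇ suc i then x else 0)
incident-pathEdge zero    zero    x = sym (+-identityʳ x)
incident-pathEdge zero    (suc i) x = refl
incident-pathEdge (suc u) zero    x = refl
incident-pathEdge (suc u) (suc i) x = incident-pathEdge u i x

cliqueSum : (ℕ → ℕ → ℕ) → ℕ → ℕ → ℕ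
cliqueSum ℓ s t = ∑[ j < s ] ∑[ i < j ] (if (t ≡ᵇ i) ∨ (t ≡ᵇ j) then ℓ i j else 0)

cliqueSum-cong : ∀ {ℓ ℓ′ : ℕ → ℕ → ℕ} s t → (∀ i j → i < j → j < s → ℓ i j ≡ ℓ′ i j) → cliqueSum ℓ s t ≡ cliqueSum ℓ′ s t
cliqueSum-cong s t eq = ∑-cong s (λ j j<s → ∑-cong j (λ i i<j →
  cong (λ x → if (t ≡ᵇ i) ∨ (t ≡ᵇ j) then x else 0) (eq i j i<j j<s)))

-- The layout of the edge list of C_k ∨ K_s: the k cycle edges (i , i+1) and (k-1 , 0), then the
-- clique edge (k+i , k+j) (i < j) at position k + triangle j + i, then the join edge (i , k+j)
-- at position k + triangle s + (i * s + j).
module JoinGraph (k s : ℕ) where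

  G : Graph
  G = cycleJoinComplete k s

  P : ℕ
  P = k + triangle s

  cliqueBlock : ℕ → List (ℕ × ℕ)
  cliqueBlock j = map (λ i → (k + i , k + j)) (upTo j)

  joinBlock : ℕ → List (ℕ × ℕ)
  joinBlock i = map (λ j → (i , k + j)) (upTo s)

  data Edge : ℕ → ℕ → Set where
    path    : ∀ {i} → i < k ∸ 1 → Edge i (suc i)
    closing : Edge (k ∸ 1) 0
    clique  : ∀ {i j} → i < j → j < s → Edge (k + i) (k + j)
    join    : ∀ {i j} → i < k → j < s → Edge i (k + j)

  edge-classification : ∀ {u v} → (u , v) ∈ edges G → Edge u v
  edge-classification uv∈ with ∈-++⁻ (cycleEdges k) uv∈
  ... | inj₁ uv∈cycle with ∈-++⁻ (map (λ i → (i , suc i)) (upTo (k ∸ 1))) uv∈cycle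
  ...   | inj₁ uv∈path with i , i∈ , refl ← ∈-map⁻ (λ i → (i , suc i)) uv∈path =
          path (∈-upTo⁻ i∈)
  ...   | inj₂ (here refl) = closing
  edge-classification uv∈ | inj₂ uv∈rest with ∈-++⁻ (cliqueEdges k s) uv∈rest
  ... | inj₁ uv∈clique with j , j<s , uv∈block ← applyUpTo⁻ (λ x → x) (∈-concatMap⁻ cliqueBlock {xs = upTo s} uv∈clique)
                       with i , i∈ , refl ← ∈-map⁻ (λ i → (k + i , k + j)) uv∈block = clique (∈-upTo⁻ i∈) j<s
  ... | inj₂ uv∈join   with i , i<k , uv∈block ← applyUpTo⁻ (λ x → x) (∈-concatMap⁻ joinBlock {xs = upTo k} uv∈join)
                       with j , j∈ , refl ← ∈-map⁻ (λ j → (i , k + j)) uv∈block = join i<k (∈-upTo⁻ j∈)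

  path-edge∈ : ∀ {i} → suc i < k → (i , suc i) ∈ edges G
  path-edge∈ i+1<k = ∈-++⁺ˡ (∈-++⁺ˡ (∈-map⁺ _ (∈-upTo⁺ (∸-monoˡ-< i+1<k (s≤s z≤n)))))

  clique-edge∈ : ∀ {i j} → i < j → j < s → (k + i , k + j) ∈ edges G
  clique-edge∈ i<j j<s =
    ∈-++⁺ʳ (cycleEdges k) (∈-++⁺ˡ (∈-concatMap⁺ _ (applyUpTo⁺ (λ x → x) (∈-map⁺ _ (∈-upTo⁺ i<j)) j<s)))

  join-edge∈ : ∀ {i j} → i < k → j < s → (i , k + j) ∈ edges G
  join-edge∈ i<k j<s =
    ∈-++⁺ʳ (cycleEdges k) (∈-++⁺ʳ (cliqueEdges k s) (∈-concatMap⁺ _ (applyUpTo⁺ (λ x → x) (∈-map⁺ _ (∈-upTo⁺ j<s)) i<k)))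

  length-cycleEdges : 1 ≤ k → length (cycleEdges k) ≡ k
  length-cycleEdges 1≤k = begin
    length (map (λ i → (i , suc i)) (upTo (k ∸ 1)) ++ (k ∸ 1 , 0) ∷ [])
      ≡⟨ length-++ (map (λ i → (i , suc i)) (upTo (k ∸ 1))) ⟩
    length (map (λ i → (i , suc i)) (upTo (k ∸ 1))) + 1
      ≡⟨ cong (_+ 1) (trans (length-map (λ i → (i , suc i)) (upTo (k ∸ 1))) (length-applyUpTo (λ x → x) (k ∸ 1))) ⟩
    k ∸ 1 + 1
      ≡⟨ m∸n+n≡m 1≤k ⟩
    k ∎
    where open ≡-Reasoning

  length-cliqueBlock : ∀ j → length (cliqueBlock j) ≡ j
  length-cliqueBlock j = trans (length-map (λ i → (k + i , k + j)) (upTo j)) (length-applyUpTo (λ x → x) j)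

  length-joinBlock : ∀ i → length (joinBlock i) ≡ s
  length-joinBlock i = trans (length-map (λ j → (i , k + j)) (upTo s)) (length-applyUpTo (λ x → x) s)

  length-cliqueEdges : length (cliqueEdges k s) ≡ triangle s
  length-cliqueEdges = trans (length-concatMap cliqueBlock (λ x → x) s) (∑-cong s (λ j _ → length-cliqueBlock j))

  length-joinEdges : length (joinEdges k s) ≡ k * s
  length-joinEdges =
    trans (length-concatMap joinBlock (λ x → x) k) (trans (∑-cong k (λ i _ → length-joinBlock i)) (∑-const k s))

  edgeCount : 1 ≤ k → |E| G ≡ P + k * s
  edgeCount 1≤k = begin
    length (cycleEdges k ++ cliqueEdges k s ++ joinEdges k s)
      ≡⟨ length-++ (cycleEdges k) ⟩
    length (cycleEdges k) + length (cliqueEdges k s ++ joinEdges k s)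
      ≡⟨ cong₂ _+_ (length-cycleEdges 1≤k) (trans (length-++ (cliqueEdges k s)) (cong₂ _+_ length-cliqueEdges length-joinEdges)) ⟩
    k + (triangle s + k * s)
      ≡⟨ +-assoc k (triangle s) (k * s) ⟨
    P + k * s ∎
    where open ≡-Reasoning

  cyclePart cliquePart joinPart : (ℕ → ℕ) → ℕ → ℕ
  cyclePart w u = ∑[ i < k ∸ 1 ] (if incident u (i , suc i) then w i else 0)
                  + (if incident u (k ∸ 1 , 0) then w (k ∸ 1) else 0)
  cliquePart w u = ∑[ j < s ] ∑[ i < j ] (if incident u (k + i , k + j) then w (k + triangle j + i) else 0)
  joinPart w u = ∑[ i < k ] ∑[ j < s ] (if incident u (i , k + j) then w (P + (i * s + j)) else 0)

  incidentSum-cycleEdges : 1 ≤ k → ∀ w u → incidentSum w u (cycleEdges k) 0 ≡ cyclePart w u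
  incidentSum-cycleEdges 1≤k w u = begin
    incidentSum w u (cycleBlock ++ (k ∸ 1 , 0) ∷ []) 0
      ≡⟨ incidentSum-++ w u cycleBlock _ 0 ⟩
    incidentSum w u cycleBlock 0 + ((if incident u (k ∸ 1 , 0) then w (length cycleBlock) else 0) + 0)
      ≡⟨ cong₂ _+_ (incidentSum-map w u (λ i → (i , suc i)) (λ x → x) (k ∸ 1) 0)
           (trans (+-identityʳ _) (cong (λ p → if incident u (k ∸ 1 , 0) then w p else 0) length-cycleBlock)) ⟩
    cyclePart w u ∎
    where
    open ≡-Reasoning
    cycleBlock : List (ℕ × ℕ)
    cycleBlock = map (λ i → (i , suc i)) (upTo (k ∸ 1))
    length-cycleBlock : length cycleBlock ≡ k ∸ 1
    length-cycleBlock = trans (length-map (λ i → (i , suc i)) (upTo (k ∸ 1))) (length-applyUpTo (λ x → x) (k ∸ 1))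

  incidentSum-cliqueEdges : ∀ w u → incidentSum w u (cliqueEdges k s) k ≡ cliquePart w u
  incidentSum-cliqueEdges w u =
    trans (incidentSum-concatMap w u cliqueBlock (λ x → x) s k)
      (∑-cong s (λ j _ → trans (incidentSum-map w u (λ i → (k + i , k + j)) (λ x → x) j _)
        (∑-cong j (λ i _ → cong (λ o → if incident u (k + i , k + j) then w (k + o + i) else 0)
          (∑-cong j (λ i′ _ → length-cliqueBlock i′))))))

  incidentSum-joinEdges : ∀ w u → incidentSum w u (joinEdges k s) P ≡ joinPart w u
  incidentSum-joinEdges w u =
    trans (incidentSum-concatMap w u joinBlock (λ x → x) k P)
      (∑-cong k (λ i _ → trans (incidentSum-map w u (λ j → (i , k + j)) (λ x → x) s _)
        (∑-cong s (λ j _ → cong (λ p → if incident u (i , k + j) then w p else 0)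
          (trans (cong (λ o → P + o + j) (trans (∑-cong i (λ i′ _ → length-joinBlock i′)) (∑-const i s)))
                 (+-assoc P (i * s) j))))))

  incidentSum-split : 1 ≤ k → ∀ w u → incidentSum w u (edges G) 0 ≡ cyclePart w u + (cliquePart w u + joinPart w u)
  incidentSum-split 1≤k w u = begin
    incidentSum w u (cycleEdges k ++ cliqueEdges k s ++ joinEdges k s) 0
      ≡⟨ incidentSum-++ w u (cycleEdges k) _ 0 ⟩
    incidentSum w u (cycleEdges k) 0 + incidentSum w u (cliqueEdges k s ++ joinEdges k s) (length (cycleEdges k))
      ≡⟨ cong₂ _+_ (incidentSum-cycleEdges 1≤k w u)
           (trans (cong (incidentSum w u (cliqueEdges k s ++ joinEdges k s)) (length-cycleEdges 1≤k)) (incidentSum-++ w u (cliqueEdges k s) _ k)) ⟩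
    cyclePart w u + (incidentSum w u (cliqueEdges k s) k + incidentSum w u (joinEdges k s) (k + length (cliqueEdges k s)))
      ≡⟨ cong (λ x → cyclePart w u + x) (cong₂ _+_ (incidentSum-cliqueEdges w u)
           (trans (cong (λ o → incidentSum w u (joinEdges k s) (k + o)) length-cliqueEdges) (incidentSum-joinEdges w u))) ⟩
    cyclePart w u + (cliquePart w u + joinPart w u) ∎
    where open ≡-Reasoning

  prev : ℕ → ℕ
  prev zero    = k ∸ 1
  prev (suc v) = v

  cyclePart-cycle : 2 ≤ k → ∀ w u → u < k → cyclePart w u ≡ w u + w (prev u)
  cyclePart-cycle 2≤k w u u<k = trans (cong (_+ wrapping u) split) (evaluate u u<k)
    where
    open ≡-Reasoning
    leaving entering wrapping : ℕ → ℕ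
    leaving  u = ∑[ i < k ∸ 1 ] (if u ≡ᵇ i then w i else 0)
    entering u = ∑[ i < k ∸ 1 ] (if u ≡ᵇ suc i then w i else 0)
    wrapping u = if incident u (k ∸ 1 , 0) then w (k ∸ 1) else 0

    split : ∑[ i < k ∸ 1 ] (if incident u (i , suc i) then w i else 0) ≡ leaving u + entering u
    split = trans (∑-cong (k ∸ 1) (λ i _ → incident-pathEdge u i (w i))) (∑-+ (k ∸ 1) _ _)

    evaluate : ∀ u → u < k → leaving u + entering u + wrapping u ≡ w u + w (prev u)
    evaluate zero _ = begin
      leaving 0 + entering 0 + wrapping 0
        ≡⟨ cong₂ (λ x y → x + y + wrapping 0) (∑-indicator (k ∸ 1) 0 w (∸-monoˡ-≤ 1 2≤k)) (∑-zero (k ∸ 1) (λ _ _ → refl)) ⟩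
      w 0 + 0 + wrapping 0
        ≡⟨ cong₂ _+_ (+-identityʳ (w 0)) (cong (λ g → if g then w (k ∸ 1) else 0) (∨-zeroʳ (0 ≡ᵇ k ∸ 1))) ⟩
      w 0 + w (k ∸ 1) ∎
    evaluate (suc v) v<k with suc v <? k ∸ 1
    ... | yes v+1<k-1 = begin
      leaving (suc v) + entering (suc v) + wrapping (suc v)
        ≡⟨ cong₂ (λ x y → x + y + wrapping (suc v)) (∑-indicator (k ∸ 1) (suc v) w v+1<k-1) (∑-indicator (k ∸ 1) v w (<-trans (n<1+n v) v+1<k-1)) ⟩
      w (suc v) + w v + wrapping (suc v)
        ≡⟨ cong (λ g → w (suc v) + w v + (if g ∨ false then w (k ∸ 1) else 0)) (<⇒≡ᵇ-false v+1<k-1) ⟩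
      w (suc v) + w v + 0
        ≡⟨ +-identityʳ _ ⟩
      w (suc v) + w v ∎
    ... | no v+1≮k-1 = begin
      leaving (suc v) + entering (suc v) + wrapping (suc v)
        ≡⟨ cong₂ (λ x y → x + y + wrapping (suc v)) (∑-indicator-out (k ∸ 1) (suc v) w (≮⇒≥ v+1≮k-1)) (∑-indicator (k ∸ 1) v w (∸-monoˡ-< v<k (s≤s z≤n))) ⟩
      w v + wrapping (suc v)
        ≡⟨ cong (λ g → w v + (if g ∨ false then w (k ∸ 1) else 0)) (trans (cong (suc v ≡ᵇ_) (sym v+1≡k-1)) (≡ᵇ-refl (suc v))) ⟩
      w v + w (k ∸ 1)
        ≡⟨ cong (λ p → w v + w p) (sym v+1≡k-1) ⟩
      w v + w (suc v)
        ≡⟨ +-comm (w v) (w (suc v)) ⟩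
      w (suc v) + w v ∎
      where
      v+1≡k-1 : suc v ≡ k ∸ 1
      v+1≡k-1 = ≤-antisym (∸-monoˡ-≤ 1 v<k) (≮⇒≥ v+1≮k-1)

  cyclePart-clique : 2 ≤ k → ∀ w u → k ≤ u → cyclePart w u ≡ 0
  cyclePart-clique 2≤k w u k≤u = cong₂ _+_
    (∑-zero (k ∸ 1) (λ i i<k-1 → cong (λ g → if g then w i else 0)
      (cong₂ _∨_ (>⇒≡ᵇ-false (smaller (<-trans i<k-1 k-1<k))) (>⇒≡ᵇ-false (smaller (≤-<-trans i<k-1 k-1<k))))))
    (cong (λ g → if g then w (k ∸ 1) else 0) (cong₂ _∨_ (>⇒≡ᵇ-false (smaller k-1<k)) (>⇒≡ᵇ-false (smaller (≤-trans (s≤s z≤n) 2≤k)))))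
    where
    smaller : ∀ {i} → i < k → i < u
    smaller i<k = <-≤-trans i<k k≤u
    k-1<k : k ∸ 1 < k
    k-1<k = ∸-monoʳ-< {o = 0} z<s (≤-trans (s≤s z≤n) 2≤k)

  cliquePart-cycle : ∀ w u → u < k → cliquePart w u ≡ 0
  cliquePart-cycle w u u<k = ∑-zero s (λ j _ → ∑-zero j (λ i _ → cong (λ g → if g then w (k + triangle j + i) else 0)
    (cong₂ _∨_ (<⇒≡ᵇ-false (<-≤-trans u<k (m≤m+n k i))) (<⇒≡ᵇ-false (<-≤-trans u<k (m≤m+n k j))))))

  cliquePart-clique : ∀ w t → cliquePart w (k + t) ≡ cliqueSum (λ i j → w (k + triangle j + i)) s t
  cliquePart-clique w t = ∑-cong s (λ j _ → ∑-cong j (λ i _ → cong (λ g → if g then w (k + triangle j + i) else 0)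
    (cong₂ _∨_ (≡ᵇ-+ k t i) (≡ᵇ-+ k t j))))

  joinPart-cycle : ∀ w u → u < k → joinPart w u ≡ ∑[ j < s ] w (P + (u * s + j))
  joinPart-cycle w u u<k = begin
    joinPart w u
      ≡⟨ ∑-cong k (λ i _ → ∑-guard s (u ≡ᵇ i) (λ j → u ≡ᵇ k + j) (λ j → w (P + (i * s + j)))
           (λ j _ → <⇒≡ᵇ-false (<-≤-trans u<k (m≤m+n k j)))) ⟩
    ∑[ i < k ] (if u ≡ᵇ i then ∑[ j < s ] w (P + (i * s + j)) else 0)
      ≡⟨ ∑-indicator k u (λ i → ∑[ j < s ] w (P + (i * s + j))) u<k ⟩
    ∑[ j < s ] w (P + (u * s + j)) ∎
    where open ≡-Reasoning

  joinPart-clique : ∀ w t → t < s → joinPart w (k + t) ≡ ∑[ i < k ] w (P + (i * s + t))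
  joinPart-clique w t t<s = ∑-cong k (λ i i<k → begin
    ∑[ j < s ] (if incident (k + t) (i , k + j) then w (P + (i * s + j)) else 0)
      ≡⟨ ∑-cong s (λ j _ → cong (λ g → if g then w (P + (i * s + j)) else 0)
           (cong₂ _∨_ (>⇒≡ᵇ-false (<-≤-trans i<k (m≤m+n k t))) (≡ᵇ-+ k t j))) ⟩
    ∑[ j < s ] (if t ≡ᵇ j then w (P + (i * s + j)) else 0)
      ≡⟨ ∑-indicator s t (λ j → w (P + (i * s + j))) t<s ⟩
    w (P + (i * s + t)) ∎)
    where open ≡-Reasoning

  incidentSum-cycle : 2 ≤ k → ∀ w u → u < k →
    incidentSum w u (edges G) 0 ≡ w u + w (prev u) + ∑[ j < s ] w (P + (u * s + j))
  incidentSum-cycle 2≤k w u u<k = begin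
    incidentSum w u (edges G) 0
      ≡⟨ incidentSum-split (≤-trans (s≤s z≤n) 2≤k) w u ⟩
    cyclePart w u + (cliquePart w u + joinPart w u)
      ≡⟨ cong₂ _+_ (cyclePart-cycle 2≤k w u u<k) (cong₂ _+_ (cliquePart-cycle w u u<k) (joinPart-cycle w u u<k)) ⟩
    w u + w (prev u) + ∑[ j < s ] w (P + (u * s + j)) ∎
    where open ≡-Reasoning

  incidentSum-clique : 2 ≤ k → ∀ w t → t < s →
    incidentSum w (k + t) (edges G) 0 ≡ cliqueSum (λ i j → w (k + triangle j + i)) s t + ∑[ i < k ] w (P + (i * s + t))
  incidentSum-clique 2≤k w t t<s = begin
    incidentSum w (k + t) (edges G) 0
      ≡⟨ incidentSum-split (≤-trans (s≤s z≤n) 2≤k) w (k + t) ⟩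
    cyclePart w (k + t) + (cliquePart w (k + t) + joinPart w (k + t))
      ≡⟨ cong₂ _+_ (cyclePart-clique 2≤k w (k + t) (m≤m+n k t)) (cong₂ _+_ (cliquePart-clique w t) (joinPart-clique w t t<s)) ⟩
    cliqueSum (λ i j → w (k + triangle j + i)) s t + ∑[ i < k ] w (P + (i * s + t)) ∎
    where open ≡-Reasoning

  bigClique : List ℕ
  bigClique = 0 ∷ 1 ∷ map (k +_) (upTo s)

  length-bigClique : length bigClique ≡ s + 2
  length-bigClique = trans (cong (λ n → suc (suc n)) (trans (length-map (k +_) (upTo s)) (length-upTo s))) (+-comm 2 s)

  bigClique-vertices : 2 ≤ k → All (_< order G) bigClique
  bigClique-vertices 2≤k =
    ≤-trans (s≤s z≤n) 1<k+s ∷ 1<k+s ∷ Allₚ.map⁺ (Allₚ.applyUpTo⁺₁ (λ x → x) s (+-monoʳ-< k))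
    where
    1<k+s : 1 < k + s
    1<k+s = ≤-trans 2≤k (m≤m+n k s)

  bigClique-adjacent : 2 ≤ k → AllPairs (λ u v → (u , v) ∈ edges G) bigClique
  bigClique-adjacent 2≤k =
    (path-edge∈ 2≤k ∷ toClique (join-edge∈ (≤-trans (s≤s z≤n) 2≤k))) ∷
    toClique (join-edge∈ 2≤k) ∷
    AllPairsₚ.map⁺ (AllPairsₚ.applyUpTo⁺₁ (λ x → x) s clique-edge∈)
    where
    toClique : ∀ {u} → (∀ {t} → t < s → (u , k + t) ∈ edges G) → All (λ v → (u , v) ∈ edges G) (map (k +_) (upTo s))
    toClique u∼ = Allₚ.map⁺ (Allₚ.applyUpTo⁺₁ (λ x → x) s u∼)

module CliqueSumMonotone (ℓ : ℕ → ℕ → ℕ)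
  (ℓ-monoˡ : ∀ i j → ℓ i j ≤ ℓ (suc i) j) (ℓ-monoʳ : ∀ i j → ℓ i j ≤ ℓ i (suc j)) where

  column : ℕ → ℕ → ℕ
  column j t = ∑[ i < j ] (if (t ≡ᵇ i) ∨ (t ≡ᵇ j) then ℓ i j else 0)

  column-above : ∀ {t j} → t < j → column j t ≡ ℓ t j
  column-above {t} {j} t<j = trans
    (∑-cong j (λ i _ → cong (λ g → if g then ℓ i j else 0) (trans (cong ((t ≡ᵇ i) ∨_) (<⇒≡ᵇ-false t<j)) (∨-identityʳ _))))
    (∑-indicator j t (λ i → ℓ i j) t<j)

  column-below : ∀ {t j} → j < t → column j t ≡ 0
  column-below {t} {j} j<t = trans
    (∑-cong j (λ i _ → cong (λ g → if g then ℓ i j else 0) (trans (cong ((t ≡ᵇ i) ∨_) (>⇒≡ᵇ-false j<t)) (∨-identityʳ _))))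
    (∑-indicator-out j t (λ i → ℓ i j) (<⇒≤ j<t))

  column-diagonal : ∀ t → column t t ≡ ∑[ i < t ] ℓ i t
  column-diagonal t = ∑-cong t (λ i _ → cong (λ g → if g then ℓ i t else 0)
    (trans (cong ((t ≡ᵇ i) ∨_) (≡ᵇ-refl t)) (∨-zeroʳ _)))

  -- Passing from t to t + 1 only the columns t and t + 1 lose weight, and column t + 1 regains it.
  cliqueSum-step : ∀ s t → suc t < s → cliqueSum ℓ s t ≤ cliqueSum ℓ s (suc t)
  cliqueSum-step s t t+1<s = begin
    cliqueSum ℓ s t
      ≡⟨ split t ⟩
    ∑[ j < t ] column j t + (column t t + (column (suc t) t + rest t))
      ≡⟨ cong₂ _+_ (∑-zero t (λ j j<t → column-below j<t))
           (cong₂ (λ y z → y + (z + rest t)) (column-diagonal t) (column-above (n<1+n t))) ⟩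
    ∑[ i < t ] ℓ i t + (ℓ t (suc t) + rest t)
      ≡⟨ +-assoc (∑[ i < t ] ℓ i t) (ℓ t (suc t)) (rest t) ⟨
    ∑[ i < t ] ℓ i t + ℓ t (suc t) + rest t
      ≤⟨ +-mono-≤ diagonal≤ rest≤ ⟩
    column (suc t) (suc t) + rest (suc t)
      ≡⟨ cong₂ (λ x y → x + (y + (column (suc t) (suc t) + rest (suc t))))
           (∑-zero t (λ j j<t → column-below (<-trans j<t (n<1+n t)))) (column-below (n<1+n t)) ⟨
    ∑[ j < t ] column j (suc t) + (column t (suc t) + (column (suc t) (suc t) + rest (suc t)))
      ≡⟨ split (suc t) ⟨
    cliqueSum ℓ s (suc t) ∎
    where
    open ≤-Reasoning
    r : ℕ
    r = s ∸ suc (suc t)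
    s≡ : t + suc (suc r) ≡ s
    s≡ = trans (+-suc t (suc r)) (trans (cong suc (+-suc t r)) (m+[n∸m]≡n t+1<s))
    rest : ℕ → ℕ
    rest x = ∑[ i < r ] column (t + suc (suc i)) x
    split : ∀ x → cliqueSum ℓ s x ≡ ∑[ j < t ] column j x + (column t x + (column (suc t) x + rest x))
    split x = trans (cong (λ n → ∑[ j < n ] column j x) (sym s≡)) (∑-around t r (λ j → column j x))
    diagonal≤ : ∑[ i < t ] ℓ i t + ℓ t (suc t) ≤ column (suc t) (suc t)
    diagonal≤ = begin
      ∑[ i < t ] ℓ i t + ℓ t (suc t)        ≤⟨ +-monoˡ-≤ (ℓ t (suc t)) (∑-mono t (λ i _ → ℓ-monoʳ i t)) ⟩
      ∑[ i < t ] ℓ i (suc t) + ℓ t (suc t)  ≡⟨ ∑-last t (λ i → ℓ i (suc t)) ⟨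
      ∑[ i < suc t ] ℓ i (suc t)            ≡⟨ column-diagonal (suc t) ⟨
      column (suc t) (suc t)                ∎
    rest≤ : rest t ≤ rest (suc t)
    rest≤ = ∑-mono r (λ i _ → begin
      column (t + suc (suc i)) t        ≡⟨ column-above (m<m+n t z<s) ⟩
      ℓ t (t + suc (suc i))             ≤⟨ ℓ-monoˡ t _ ⟩
      ℓ (suc t) (t + suc (suc i))       ≡⟨ column-above (subst (suc t <_) (sym (+-suc t (suc i))) (s<s (m<m+n t z<s))) ⟨
      column (t + suc (suc i)) (suc t)  ∎)

parity half : ℕ → ℕ
parity zero          = 0
parity (suc zero)    = 1
parity (suc (suc v)) = parity v
half zero          = 0
half (suc zero)    = 0
half (suc (suc v)) = suc (half v)

two-suc : ∀ x → 2 * suc x ≡ suc (suc (2 * x))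
two-suc x = cong suc (+-suc x (x + 0))

parity+half : ∀ v → parity v + 2 * half v ≡ v
parity+half zero          = refl
parity+half (suc zero)    = refl
parity+half (suc (suc v)) = begin
  parity v + 2 * suc (half v)          ≡⟨ cong (parity v +_) (two-suc (half v)) ⟩
  parity v + suc (suc (2 * half v))    ≡⟨ +-suc (parity v) _ ⟩
  suc (parity v + suc (2 * half v))    ≡⟨ cong suc (+-suc (parity v) _) ⟩
  suc (suc (parity v + 2 * half v))    ≡⟨ cong (λ x → suc (suc x)) (parity+half v) ⟩
  suc (suc v)                          ∎
  where open ≡-Reasoning

parity-01 : ∀ v → parity v ≡ 0 ⊎ parity v ≡ 1
parity-01 zero          = inj₁ refl
parity-01 (suc zero)    = inj₂ refl
parity-01 (suc (suc v)) = parity-01 v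

parity≤1 : ∀ v → parity v ≤ 1
parity≤1 zero          = z≤n
parity≤1 (suc zero)    = ≤-refl
parity≤1 (suc (suc v)) = parity≤1 v

parity-suc : ∀ v → parity (suc v) ≢ parity v
parity-suc zero          ()
parity-suc (suc zero)    ()
parity-suc (suc (suc v)) = parity-suc v

bit+2*suc : ∀ c x → c + 2 * suc x ≡ suc (suc (c + 2 * x))
bit+2*suc c x = trans (cong (c +_) (two-suc x)) (trans (+-suc c _) (cong suc (+-suc c _)))

parity-bit+2* : ∀ c x → c ≤ 1 → parity (c + 2 * x) ≡ c
parity-bit+2* zero          zero    _        = refl
parity-bit+2* (suc zero)    zero    _        = refl
parity-bit+2* (suc (suc c)) zero    (s≤s ())
parity-bit+2* c             (suc x) c≤1      = trans (cong parity (bit+2*suc c x)) (parity-bit+2* c x c≤1)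

half-bit+2* : ∀ c x → c ≤ 1 → half (c + 2 * x) ≡ x
half-bit+2* zero          zero    _        = refl
half-bit+2* (suc zero)    zero    _        = refl
half-bit+2* (suc (suc c)) zero    (s≤s ())
half-bit+2* c             (suc x) c≤1      = trans (cong half (bit+2*suc c x)) (cong suc (half-bit+2* c x c≤1))

half-< : ∀ h {v} → v < 2 * suc h → half v ≤ h
half-< h {v} v<2h+2 = ≮⇒≥ (λ h<half → <-irrefl refl (<-≤-trans v<2h+2 (begin
  2 * suc h               ≤⟨ *-monoʳ-≤ 2 h<half ⟩
  2 * half v              ≤⟨ m≤n+m (2 * half v) (parity v) ⟩
  parity v + 2 * half v   ≡⟨ parity+half v ⟩
  v                       ∎)))
  where open ≤-Reasoning

module Construction (a b : ℕ) where

  h k s : ℕ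
  h = suc a
  k = 2 * suc h
  s = 2 * suc b

  open JoinGraph k s

  2≤k : 2 ≤ k
  2≤k = s≤s (s≤s z≤n)

  4≤k : 4 ≤ k
  4≤k = *-monoʳ-≤ 2 (s≤s (s≤s z≤n))

  reflect : ℕ → ℕ
  reflect v = k ∸ suc v

  -- v ↦ -v modulo k
  negate : ℕ → ℕ
  negate zero    = 0
  negate (suc v) = reflect v

  -- the pair {2p, 2p+1} is exchanged with the pair {2(h-p), 2(h-p)+1}, preserving parity
  pairSwap : ℕ → ℕ
  pairSwap v = parity v + 2 * (h ∸ half v)

  alternate : ℕ → ℕ → ℕ
  alternate zero          v = v
  alternate (suc zero)    v = reflect v
  alternate (suc (suc j)) v = alternate j v

  π : ℕ → ℕ → ℕ
  π zero          = pairSwap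
  π (suc zero)    = negate
  π (suc (suc j)) = alternate j

  reflect-< : ∀ v → reflect v < k
  reflect-< v = s≤s (m∸n≤m _ v)

  reflect-involutive : ∀ {v} → v < k → reflect (reflect v) ≡ v
  reflect-involutive (s≤s v≤k-1) = m∸[m∸n]≡n v≤k-1

  negate-involutive : ∀ {v} → v < k → negate (negate v) ≡ v
  negate-involutive {zero}  _     = refl
  negate-involutive {suc v} v+1<k with reflect v in eq
  ... | zero  = contradiction eq (>⇒≢ (m<n⇒0<n∸m v+1<k))
  ... | suc w = begin
    k ∸ suc w               ≡⟨ cong (k ∸_) eq ⟨
    k ∸ (k ∸ suc v)         ≡⟨ m∸[m∸n]≡n (<⇒≤ v+1<k) ⟩
    suc v                   ∎
    where open ≡-Reasoning

  pairSwap-< : ∀ v → pairSwap v < k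
  pairSwap-< v = begin-strict
    parity v + 2 * (h ∸ half v)   ≤⟨ +-mono-≤ (parity≤1 v) (*-monoʳ-≤ 2 (m∸n≤m h (half v))) ⟩
    1 + 2 * h                     <⟨ n<1+n _ ⟩
    suc (suc (2 * h))             ≡⟨ two-suc h ⟨
    k                             ∎
    where open ≤-Reasoning

  pairSwap-involutive : ∀ {v} → v < k → pairSwap (pairSwap v) ≡ v
  pairSwap-involutive {v} v<k = begin
    parity (pairSwap v) + 2 * (h ∸ half (pairSwap v))
      ≡⟨ cong₂ (λ p q → p + 2 * (h ∸ q)) (parity-bit+2* (parity v) (h ∸ half v) (parity≤1 v)) (half-bit+2* (parity v) (h ∸ half v) (parity≤1 v)) ⟩
    parity v + 2 * (h ∸ (h ∸ half v))
      ≡⟨ cong (λ q → parity v + 2 * q) (m∸[m∸n]≡n (half-< h v<k)) ⟩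
    parity v + 2 * half v
      ≡⟨ parity+half v ⟩
    v ∎
    where open ≡-Reasoning

  alternate-< : ∀ j {v} → v < k → alternate j v < k
  alternate-< zero          v<k = v<k
  alternate-< (suc zero)    {v} _ = reflect-< v
  alternate-< (suc (suc j)) v<k = alternate-< j v<k

  alternate-involutive : ∀ j {v} → v < k → alternate j (alternate j v) ≡ v
  alternate-involutive zero          _   = refl
  alternate-involutive (suc zero)    v<k = reflect-involutive v<k
  alternate-involutive (suc (suc j)) v<k = alternate-involutive j v<k

  π-< : ∀ j {v} → v < k → π j v < k
  π-< zero          {v}     _   = pairSwap-< v
  π-< (suc zero)    {zero}  v<k = v<k
  π-< (suc zero)    {suc v} _   = reflect-< v
  π-< (suc (suc j))         v<k = alternate-< j v<k

  π-involutive : ∀ j {v} → v < k → π j (π j v) ≡ v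
  π-involutive zero          v<k = pairSwap-involutive v<k
  π-involutive (suc zero)    v<k = negate-involutive v<k
  π-involutive (suc (suc j)) v<k = alternate-involutive j v<k

  -- The edge at position p gets the label swap p + 1: the cycle edges keep the labels 1, …, k, the
  -- join edge (i , k+j) gets the label k + j * k + π j i + 1, and the clique edges get the largest labels.
  open TwistedTranspose k s π π-< π-involutive
  open BlockSwap k (triangle s) (k * s) twist untwist twist-< untwist-< untwist∘twist twist∘untwist

  E≡ : |E| G ≡ P + k * s
  E≡ = edgeCount (≤-trans (s≤s z≤n) 2≤k)

  private
    inRange : ∀ {p} → p < |E| G → p < P + k * s
    inRange {p} = subst (p <_) E≡

  module Labels = PermutationLabeling G swap unswap
    (λ p p<E → subst (swap p <_) (sym E≡) (swap-< (inRange p<E)))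
    (λ r r<E → subst (unswap r <_) (sym E≡) (unswap-< (inRange r<E)))
    (λ p p<E → unswap∘swap (inRange p<E))
    (λ r r<E → swap∘unswap (inRange r<E))

  labeling : Labeling G
  labeling = Labels.permLabeling

  fp : ℕ → ℕ
  fp = fplus G labeling

  joinLabel cliqueLabel : ℕ → ℕ → ℕ
  joinLabel i j   = suc (k + (j * k + π j i))
  cliqueLabel i j = suc (k + triangle j + i + k * s)

  prev-< : ∀ {u} → u < k → prev u < k
  prev-< {zero}  _     = n<1+n _
  prev-< {suc v} v+1<k = <-trans (n<1+n v) v+1<k

  swap-clique : ∀ {i j} → i < j → j < s → swap (k + triangle j + i) ≡ k + triangle j + i + k * s
  swap-clique {i} {j} i<j j<s = swap-between (≤-trans (m≤m+n k (triangle j)) (m≤m+n _ i)) (begin-strict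
    k + triangle j + i        ≡⟨ +-assoc k (triangle j) i ⟩
    k + (triangle j + i)      <⟨ +-monoʳ-< k (+-monoʳ-< (triangle j) i<j) ⟩
    k + (triangle j + j)      ≡⟨ cong (k +_) (∑-last j (λ x → x)) ⟨
    k + triangle (suc j)      ≤⟨ +-monoʳ-≤ k (triangle-mono j<s) ⟩
    P                         ∎)
    where open ≤-Reasoning

  swap-join : ∀ i {j} → j < s → swap (P + (i * s + j)) ≡ k + (j * k + π j i)
  swap-join i {j} j<s = begin
    swap (P + (i * s + j))                     ≡⟨ swap-above (m≤m+n P (i * s + j)) ⟩
    k + twist (P + (i * s + j) ∸ P)            ≡⟨ cong (λ x → k + twist x) (m+n∸m≡n P (i * s + j)) ⟩
    k + twist (i * s + j)                      ≡⟨ cong (k +_) (twist-mixed i j<s) ⟩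
    k + (j * k + π j i)                        ∎
    where open ≡-Reasoning

  fp-cycle : ∀ {u} → u < k → fp u ≡ suc u + suc (prev u) + ∑[ j < s ] joinLabel u j
  fp-cycle {u} u<k = begin
    fp u
      ≡⟨ Labels.fplus-permLabeling u ⟩
    incidentSum (λ p → suc (swap p)) u (edges G) 0
      ≡⟨ incidentSum-cycle 2≤k (λ p → suc (swap p)) u u<k ⟩
    suc (swap u) + suc (swap (prev u)) + ∑[ j < s ] suc (swap (P + (u * s + j)))
      ≡⟨ cong₂ _+_ (cong₂ (λ x y → suc x + suc y) (swap-below u<k) (swap-below (prev-< u<k)))
           (∑-cong s (λ j j<s → cong suc (swap-join u j<s))) ⟩
    suc u + suc (prev u) + ∑[ j < s ] joinLabel u j ∎
    where open ≡-Reasoning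

  fp-clique : ∀ {t} → t < s → fp (k + t) ≡ cliqueSum cliqueLabel s t + ∑[ i < k ] joinLabel i t
  fp-clique {t} t<s = begin
    fp (k + t)
      ≡⟨ Labels.fplus-permLabeling (k + t) ⟩
    incidentSum (λ p → suc (swap p)) (k + t) (edges G) 0
      ≡⟨ incidentSum-clique 2≤k (λ p → suc (swap p)) t t<s ⟩
    cliqueSum (λ i j → suc (swap (k + triangle j + i))) s t + ∑[ i < k ] suc (swap (P + (i * s + t)))
      ≡⟨ cong₂ _+_ (cliqueSum-cong s t (λ i j i<j j<s → cong suc (swap-clique i<j j<s)))
           (∑-cong k (λ i _ → cong suc (swap-join i t<s))) ⟩
    cliqueSum cliqueLabel s t + ∑[ i < k ] joinLabel i t ∎
    where open ≡-Reasoning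

  -- Each pair of alternating columns contributes v + reflect v = k - 1.
  alternate-sum : ∀ c {v} → v < k → ∑[ j < 2 * c ] alternate j v ≡ c * (k ∸ 1)
  alternate-sum zero    _ = refl
  alternate-sum (suc c) {v} v<k@(s≤s v≤k-1) = begin
    ∑[ j < 2 * suc c ] alternate j v
      ≡⟨ cong (λ n → ∑[ j < n ] alternate j v) (two-suc c) ⟩
    v + (reflect v + ∑[ j < 2 * c ] alternate j v)
      ≡⟨ +-assoc v (reflect v) _ ⟨
    v + reflect v + ∑[ j < 2 * c ] alternate j v
      ≡⟨ cong₂ _+_ (m+[n∸m]≡n v≤k-1) (alternate-sum c v<k) ⟩
    k ∸ 1 + c * (k ∸ 1) ∎
    where open ≡-Reasoning

  π-sum : ∀ {v} → v < k → ∑[ j < s ] π j v ≡ pairSwap v + (negate v + b * (k ∸ 1))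
  π-sum {v} v<k = begin
    ∑[ j < s ] π j v
      ≡⟨ cong (λ n → ∑[ j < n ] π j v) (two-suc b) ⟩
    pairSwap v + (negate v + ∑[ j < 2 * b ] alternate j v)
      ≡⟨ cong (λ x → pairSwap v + (negate v + x)) (alternate-sum b v<k) ⟩
    pairSwap v + (negate v + b * (k ∸ 1)) ∎
    where open ≡-Reasoning

  cycle+negate : ∀ {u} → u < k → suc u + suc (prev u) + negate u ≡ suc (k + u)
  cycle+negate {zero}  _ = refl
  cycle+negate {suc v} v+1<k = begin
    suc (suc v) + suc v + (k ∸ suc v)      ≡⟨ +-assoc (suc (suc v)) (suc v) _ ⟩
    suc (suc v) + (suc v + (k ∸ suc v))    ≡⟨ cong (suc (suc v) +_) (m+[n∸m]≡n (<⇒≤ v+1<k)) ⟩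
    suc (suc v) + k                        ≡⟨ cong suc (+-comm (suc v) k) ⟩
    suc (k + suc v)                        ∎
    where open ≡-Reasoning

  -- The column π 0 = pairSwap then only leaves the parity of u.
  +pairSwap : ∀ {u} → u < k → u + pairSwap u ≡ 2 * h + 2 * parity u
  +pairSwap {u} u<k = begin
    u + pairSwap u
      ≡⟨ cong (_+ pairSwap u) (parity+half u) ⟨
    parity u + 2 * half u + (parity u + 2 * (h ∸ half u))
      ≡⟨ regroup (parity u) (half u) (h ∸ half u) ⟩
    2 * (half u + (h ∸ half u)) + 2 * parity u
      ≡⟨ cong (λ x → 2 * x + 2 * parity u) (m+[n∸m]≡n (half-< h u<k)) ⟩
    2 * h + 2 * parity u ∎
    where
    open ≡-Reasoning
    regroup : ∀ p x y → p + 2 * x + (p + 2 * y) ≡ 2 * (x + y) + 2 * p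
    regroup = solve-∀

  cycleBase : ℕ
  cycleBase = ∑[ j < s ] suc (k + j * k) + b * (k ∸ 1) + suc (k + 2 * h)

  fp-cycle-parity : ∀ {u} → u < k → fp u ≡ cycleBase + 2 * parity u
  fp-cycle-parity {u} u<k = begin
    fp u
      ≡⟨ fp-cycle u<k ⟩
    X + ∑[ j < s ] joinLabel u j
      ≡⟨ cong (X +_) (trans (∑-cong s (λ j _ → cong suc (sym (+-assoc k (j * k) (π j u)))))
                            (trans (∑-+ s (λ j → suc (k + j * k)) (λ j → π j u)) (cong (R +_) (π-sum u<k)))) ⟩
    X + (R + (pairSwap u + (negate u + B)))
      ≡⟨ regroup X R (pairSwap u) (negate u) B ⟩
    R + B + (X + negate u) + pairSwap u
      ≡⟨ cong (λ y → R + B + y + pairSwap u) (cycle+negate u<k) ⟩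
    R + B + suc (k + u) + pairSwap u
      ≡⟨ shift R B k u (pairSwap u) ⟩
    R + B + suc (k + (u + pairSwap u))
      ≡⟨ cong (λ y → R + B + suc (k + y)) (+pairSwap u<k) ⟩
    R + B + suc (k + (2 * h + 2 * parity u))
      ≡⟨ shift R B k (2 * h) (2 * parity u) ⟨
    cycleBase + 2 * parity u ∎
    where
    open ≡-Reasoning
    X R B : ℕ
    X = suc u + suc (prev u)
    R = ∑[ j < s ] suc (k + j * k)
    B = b * (k ∸ 1)
    regroup : ∀ x r p n c → x + (r + (p + (n + c))) ≡ r + c + (x + n) + p
    regroup = solve-∀
    shift : ∀ r c k y z → r + c + suc (k + y) + z ≡ r + c + suc (k + (y + z))
    shift = solve-∀

  cliqueLabel-monoˡ : ∀ i j → cliqueLabel i j ≤ cliqueLabel (suc i) j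
  cliqueLabel-monoˡ i j = s≤s (+-monoˡ-≤ (k * s) (+-monoʳ-≤ (k + triangle j) (n≤1+n i)))

  cliqueLabel-monoʳ : ∀ i j → cliqueLabel i j ≤ cliqueLabel i (suc j)
  cliqueLabel-monoʳ i j = s≤s (+-monoˡ-≤ (k * s) (+-monoˡ-≤ i (+-monoʳ-≤ k (triangle-mono (n≤1+n j)))))

  open CliqueSumMonotone cliqueLabel cliqueLabel-monoˡ cliqueLabel-monoʳ

  -- The join labels at clique vertex t fill the block k + t * k + 1, …, k + t * k + k.
  joinColumn : ℕ → ℕ
  joinColumn t = ∑[ i < k ] joinLabel i t

  joinColumn-upper : ∀ t → joinColumn t ≤ k * (k + suc t * k)
  joinColumn-upper t = ≤-trans (∑-mono k (λ i i<k → label≤ i i<k)) (≤-reflexive (∑-const k (k + suc t * k)))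
    where
    label≤ : ∀ i → i < k → joinLabel i t ≤ k + suc t * k
    label≤ i i<k = begin
      suc (k + (t * k + π t i))    ≡⟨ cong suc (+-assoc k (t * k) (π t i)) ⟨
      suc (k + t * k + π t i)      ≡⟨ +-suc (k + t * k) (π t i) ⟨
      k + t * k + suc (π t i)      ≤⟨ +-monoʳ-≤ (k + t * k) (π-< t i<k) ⟩
      k + t * k + k                ≡⟨ +-assoc k (t * k) k ⟩
      k + (t * k + k)              ≡⟨ cong (k +_) (+-comm (t * k) k) ⟩
      k + suc t * k                ∎
      where open ≤-Reasoning

  joinColumn-lower : ∀ t → k * suc (k + t * k) ≤ joinColumn t
  joinColumn-lower t = ≤-trans (≤-reflexive (sym (∑-const k (suc (k + t * k)))))
    (∑-mono k (λ i _ → s≤s (+-monoʳ-≤ k (m≤m+n (t * k) (π t i)))))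

  joinColumn-step : ∀ t → joinColumn t < joinColumn (suc t)
  joinColumn-step t = begin-strict
    joinColumn t                  ≤⟨ joinColumn-upper t ⟩
    k * (k + suc t * k)           <⟨ *-monoʳ-< k (n<1+n (k + suc t * k)) ⟩
    k * suc (k + suc t * k)       ≤⟨ joinColumn-lower (suc t) ⟩
    joinColumn (suc t)            ∎
    where open ≤-Reasoning

  fp-clique-step : ∀ t → suc t < s → fp (k + t) < fp (k + suc t)
  fp-clique-step t t+1<s = subst₂ _<_ (sym (fp-clique (<-trans (n<1+n t) t+1<s))) (sym (fp-clique t+1<s))
    (+-mono-≤-< (cliqueSum-step s t t+1<s) (joinColumn-step t))

  fp-clique-increasing : ∀ {i j} → i < j → j < s → fp (k + i) < fp (k + j)
  fp-clique-increasing = increasing-by-steps (λ t → fp (k + t)) s fp-clique-step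

  joinLabel-≤ : ∀ {i j} → i < k → j < s → joinLabel i j ≤ k + k * s
  joinLabel-≤ {i} {j} i<k j<s = +-monoʳ-< k (subst (j * k + π j i <_) (*-comm s k) (mixed-< j<s (π-< j i<k)))

  cliqueLabel-> : ∀ i j → k + k * s < cliqueLabel i j
  cliqueLabel-> i j = s≤s (+-monoˡ-≤ (k * s) (≤-trans (m≤m+n k (triangle j)) (m≤m+n _ i)))

  -- The cycle vertex values lie below all clique vertex values: at the first clique vertex,
  -- the join column outweighs the cycle labels with one join label, and the clique labels
  -- outweigh the remaining join labels.
  fp-cycle<fp-clique₀ : ∀ {u} → u < k → fp u < fp (k + 0)
  fp-cycle<fp-clique₀ {u} u<k = begin-strict
    fp u
      ≡⟨ fp-cycle u<k ⟩
    X + (joinLabel u 0 + ∑[ j < s ∸ 1 ] joinLabel u (suc j))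
      ≡⟨ +-assoc X (joinLabel u 0) _ ⟨
    X + joinLabel u 0 + ∑[ j < s ∸ 1 ] joinLabel u (suc j)
      <⟨ +-mono-<-≤ head< (∑-mono (s ∸ 1) (λ j j<s-1 → later≤ (s≤s j<s-1))) ⟩
    joinColumn 0 + ∑[ j < s ∸ 1 ] column (suc j) 0
      ≡⟨ +-comm (joinColumn 0) _ ⟩
    cliqueSum cliqueLabel s 0 + joinColumn 0
      ≡⟨ fp-clique z<s ⟨
    fp (k + 0) ∎
    where
    open ≤-Reasoning
    X : ℕ
    X = suc u + suc (prev u)
    head< : X + joinLabel u 0 < joinColumn 0
    head< = begin-strict
      X + joinLabel u 0              ≤⟨ +-mono-≤ (+-mono-≤ u<k (prev-< u<k)) (≤-trans (≤-reflexive (sym (+-suc k (pairSwap u)))) (+-monoʳ-≤ k (pairSwap-< u))) ⟩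
      (k + k) + (k + k)              ≡⟨ four k ⟩
      4 * k                          ≤⟨ *-monoˡ-≤ k 4≤k ⟩
      k * k                          <⟨ *-monoʳ-< k (s≤s (m≤m+n k 0)) ⟩
      k * suc (k + 0 * k)            ≤⟨ joinColumn-lower 0 ⟩
      joinColumn 0                   ∎
      where
      four : ∀ k → (k + k) + (k + k) ≡ 4 * k
      four = solve-∀
    later≤ : ∀ {j} → suc j < s → joinLabel u (suc j) ≤ column (suc j) 0
    later≤ {j} j+1<s = begin
      joinLabel u (suc j)          ≤⟨ <⇒≤ (≤-<-trans (joinLabel-≤ u<k j+1<s) (cliqueLabel-> 0 (suc j))) ⟩
      cliqueLabel 0 (suc j)        ≡⟨ column-above {0} {suc j} z<s ⟨
      column (suc j) 0             ∎

  fp-cycle<fp-clique : ∀ {u t} → u < k → t < s → fp u < fp (k + t)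
  fp-cycle<fp-clique {t = zero}  u<k _   = fp-cycle<fp-clique₀ u<k
  fp-cycle<fp-clique {t = suc t} u<k t<s = <-trans (fp-cycle<fp-clique₀ u<k) (fp-clique-increasing z<s t<s)

  cycle-same : ∀ {u v} → u < k → v < k → parity u ≡ parity v → fp u ≡ fp v
  cycle-same {u} {v} u<k v<k same = begin
    fp u                       ≡⟨ fp-cycle-parity u<k ⟩
    cycleBase + 2 * parity u   ≡⟨ cong (λ p → cycleBase + 2 * p) same ⟩
    cycleBase + 2 * parity v   ≡⟨ fp-cycle-parity v<k ⟨
    fp v                       ∎
    where open ≡-Reasoning

  cycle-separated : ∀ {u v} → u < k → v < k → parity u ≢ parity v → fp u ≢ fp v
  cycle-separated {u} {v} u<k v<k differ eq = differ (*-cancelˡ-≡ (parity u) (parity v) 2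
    (+-cancelˡ-≡ cycleBase _ _ (trans (sym (fp-cycle-parity u<k)) (trans eq (fp-cycle-parity v<k)))))

  -- k is even, so the closing edge (k-1 , 0) joins vertices of different parity.
  parity[k-1] : parity (k ∸ 1) ≡ 1
  parity[k-1] = trans (cong (λ n → parity (n ∸ 1)) (two-suc h)) (parity-bit+2* 1 h (s≤s z≤n))

  -- The labeling is local antimagic: path and closing edges join vertices of different parity,
  -- clique values increase strictly, and cycle values lie below clique values.
  antimagic : IsLocalAntimagic G labeling
  antimagic e = separated (edge-classification (∈-lookup e))
    where
    separated : ∀ {u v} → Edge u v → fp u ≢ fp v
    separated (path {i} i<k-1) = cycle-separated (<-trans (n<1+n i) (s≤s i<k-1)) (s≤s i<k-1) (λ eq → parity-suc i (sym eq))
    separated closing          = cycle-separated (n<1+n (k ∸ 1)) z<s (λ eq → 1≢0 (trans (sym parity[k-1]) eq))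
      where
      1≢0 : 1 ≢ 0
      1≢0 ()
    separated (clique i<j j<s) = <⇒≢ (fp-clique-increasing i<j j<s)
    separated (join i<k j<s)   = <⇒≢ (fp-cycle<fp-clique i<k j<s)

  covered : ∀ u → u < order G → fp u ∈ map fp bigClique
  covered u u<k+s = cover (u <? k)
    where
    cycleVertex : u < k → parity u ≡ 0 ⊎ parity u ≡ 1 → fp u ∈ map fp bigClique
    cycleVertex u<k (inj₁ even) = here (cycle-same u<k z<s even)
    cycleVertex u<k (inj₂ odd)  = there (here (cycle-same u<k (s≤s z<s) odd))
    cover : Dec (u < k) → fp u ∈ map fp bigClique
    cover (yes u<k) = cycleVertex u<k (parity-01 u)
    cover (no u≮k)  = there (there (subst (λ v → fp v ∈ map fp (map (k +_) (upTo s))) (m+[n∸m]≡n k≤u)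
      (∈-map⁺ fp (∈-map⁺ (k +_) (∈-upTo⁺ (offset-< k≤u u<k+s))))))
      where
      k≤u : k ≤ u
      k≤u = ≮⇒≥ u≮k

  result : LocalAntimagicChromatic G (s + 2)
  result = subst (LocalAntimagicChromatic G) length-bigClique
    (chromatic-by-clique G bigClique (bigClique-vertices 2≤k) (bigClique-adjacent 2≤k) labeling antimagic covered)

mainTheorem8 : (m n : ℕ) → 2 ≤ m → 1 ≤ n →
    LocalAntimagicChromatic (cycleJoinComplete (2 * m) (2 * n)) (2 * n + 2)
mainTheorem8 (suc (suc a)) (suc b) (s≤s (s≤s z≤n)) (s≤s z≤n) = Construction.result a b
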